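{- Let $\lambda\supseteq\mu$ be strict partitions and $n$ a positive integer such that $\mathrm{SSVT}_P(\lambda/\mu,n)\neq\emptyset$ and $\mathrm{SSVT}_Q(\lambda/\mu,n)\neq\emptyset$. Then both $|\mathrm{SSVT}_P(\lambda/\mu,n)|$ and $|\mathrm{SSVT}_Q(\lambda/\mu,n)|$ are odd.
   Context: Strict partitions $\lambda=(\lambda_1>\dots>\lambda_r>0)$, $\ell(\lambda)=r$. $\lambda\supseteq\mu$ means $\lambda_i\ge\mu_i$ for all $i$ (pad $\mu$ with zeros). The shifted skew diagram is $\lambda/\mu=\{(i,j): 1\le i\le\ell(\lambda),\ \mu_i+i\le j\le\lambda_i+i-1\}$; boxes $(i,i)$ are diagonal. For $k\in[n]$ put $k'=k-\tfrac12$, $[n',n]=\{1'<1<\dots<n'<n\}$. A shifted skew set-valued tableau of shape $\lambda/\mu$ with $n$ variables assigns to each box a nonempty subset $T_{i,j}\subseteq[n',n]$ such that: (1) $\max T_{i,j}\le\min T_{i,j+1}$ and $\max T_{i,j}\le\min T_{i+1,j}$ whenever both boxes exist; (2) each unprimed $k$ appears at most once per column; (3) each primed $k'$ appears at most once per row; (4) diagonal boxes contain only unprimed entries. $\mathrm{SSVT}_P(\lambda/\mu,n)$ is the set of these; $\mathrm{SSVT}_Q(\lambda/\mu,n)$ those satisfying (1)–(3) only. -}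

module Defs where

open import Data.Nat using (ℕ; zero; suc; _+_; _*_; _∸_; _≤_; _<_; _≤ᵇ_; _%_)
open import Data.Bool using (if_then_else_)
open import Data.Fin as Fin using (Fin; toℕ)
open import Data.Fin.Subset using (Subset; _∈_; _∉_; Nonempty)
open import Data.List using (List; []; _∷_; length)
open import Data.List.Relation.Unary.All using (All)
open import Data.List.Relation.Unary.Linked using (Linked)
open import Data.List.Relation.Unary.Unique.Propositional using (Unique)
open import Data.List.Membership.Propositional using () renaming (_∈_ to _∈ₗ_)
open import Data.Maybe using (Maybe; just; nothing; _>>=_)
open import Data.Product using (Σ; ∃; ∃-syntax; _×_)
open import Function.Bundles using (_⇔_)
open import Relation.Binary.PropositionalEquality using (_≡_)

-- Partitions are lists of parts, largest first.
Partition : Set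
Partition = List ℕ

Strict : Partition → Set
Strict la = Linked (λ a b → b < a) la × All (λ a → 0 < a) la

-- i-th part (0-indexed), padded with zeros
part : Partition → ℕ → ℕ
part []       _       = 0
part (a ∷ _)  zero    = a
part (_ ∷ as) (suc r) = part as r

_⊇_ : Partition → Partition → Set
la ⊇ mu = ∀ r → part mu r ≤ part la r

_!?_ : {A : Set} → List A → ℕ → Maybe A
[]       !? _     = nothing
(x ∷ _)  !? zero  = just x
(_ ∷ xs) !? suc r = xs !? r

-- Alphabet [n',n] = {1' < 1 < 2' < 2 < … < n' < n} encoded as Fin (2n):
-- code 2(k-1) is k' and code 2(k-1)+1 is k; the order of Fin is the order of [n',n].
Letter : ℕ → Set
Letter n = Fin (2 * n)

Primed : {n : ℕ} → Letter n → Set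
Primed t = toℕ t % 2 ≡ 0

Unprimed : {n : ℕ} → Letter n → Set
Unprimed t = toℕ t % 2 ≡ 1

-- A filling of a shifted skew shape: row r (0-indexed) lists the subsets in
-- the boxes of row r+1, from left to right.
Filling : ℕ → Set
Filling n = List (List (Subset (2 * n)))

HasShape : {n : ℕ} → Partition → Partition → Filling n → Set
HasShape la mu F =
  (length F ≡ length la) ×
  (∀ r row → F !? r ≡ just row → length row ≡ part la r ∸ part mu r)

-- Content of box (i,j) (1-indexed, shifted coordinates) of the shifted skew
-- diagram λ/μ = {(i,j) : 1 ≤ i ≤ ℓ(λ), μᵢ + i ≤ j ≤ λᵢ + i - 1};
-- nothing if (i,j) is not a box (given HasShape).
box : {n : ℕ} → Partition → Filling n → ℕ → ℕ → Maybe (Subset (2 * n))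
box mu F zero    j = nothing
box mu F (suc r) j =
  if (part mu r + suc r) ≤ᵇ j
  then (F !? r) >>= (λ row → row !? (j ∸ (part mu r + suc r)))
  else nothing

_≼_ : {n : ℕ} → Subset n → Subset n → Set
A ≼ B = ∀ a b → a ∈ A → b ∈ B → a Fin.≤ b

IsSSVT-Q : (n : ℕ) → Partition → Partition → Filling n → Set
IsSSVT-Q n la mu F =
  HasShape {n} la mu F ×
  (∀ i j A → box {n} mu F i j ≡ just A → Nonempty A) ×
  (∀ i j A B → box {n} mu F i j ≡ just A → box {n} mu F i (suc j) ≡ just B → A ≼ B) ×
  (∀ i j A B → box {n} mu F i j ≡ just A → box {n} mu F (suc i) j ≡ just B → A ≼ B) ×
  (∀ i i' j A B (t : Letter n) → i < i' → box {n} mu F i j ≡ just A → box {n} mu F i' j ≡ just B →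
     Unprimed {n} t → t ∈ A → t ∉ B) ×
  (∀ i j j' A B (t : Letter n) → j < j' → box {n} mu F i j ≡ just A → box {n} mu F i j' ≡ just B →
     Primed {n} t → t ∈ A → t ∉ B)

IsSSVT-P : (n : ℕ) → Partition → Partition → Filling n → Set
IsSSVT-P n la mu F =
  IsSSVT-Q n la mu F ×
  (∀ i A (t : Letter n) → box {n} mu F i i ≡ just A → t ∈ A → Unprimed {n} t)

HasCard : {A : Set} → (A → Set) → ℕ → Set
HasCard {A} P k = ∃[ L ] (Unique L × (∀ x → (x ∈ₗ L) ⇔ P x) × length L ≡ k)

Odd : ℕ → Set
Odd k = ∃[ m ] k ≡ suc (2 * m)

{-# OPTIONS --safe #-}
module Submission where

-- The tableaux of shape λ/μ carry an involution σ with exactly one fixed point, so there are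
-- oddly many of them. Read the boxes row by row and call a box greedy if it holds exactly {x},
-- where x is the least letter compatible with the boxes before it. σ toggles x in the first box
-- that is not greedy: x lies weakly below every letter already in that box, so the result is
-- again a tableau, and its first non-greedy box and least compatible letter are the same, so σ
-- undoes itself. The fixed points are the fillings with only greedy boxes; such a filling is
-- unique (induction in reading order), and one is obtained from any tableau by making its boxes
-- greedy one at a time. P- and Q-tableaux differ only in which letters a box admits.

open import Defs
open import Data.Nat.Properties
  using (+-suc; ≤-refl; ≤-trans; ≤-<-trans; <-≤-trans; <⇒≤; n≤1+n; ≤-pred; m≤n⇒m<n∨m≡n; m<n⇒m<1+n;
         _≟_; _≤?_; _<?_; ≮⇒≥; <⇒≱; <⇒≢; >⇒≢; 1+n≢n; <-cmp; allUpTo?; anyUpTo?; <-strictTotalOrder;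
         +-monoˡ-≤; +-monoˡ-<; +-cancelʳ-<; m≤m+n; m≤n+m; m+n∸m≡n; m+[n∸m]≡n; ≤ᵇ-reflects-≤;
         suc-injective; +-commutativeSemigroup; module ≤-Reasoning)
open import Algebra.Properties.CommutativeSemigroup +-commutativeSemigroup using (xy∙z≈xz∙y)
open import Data.Bool using (true; false; not)
import Data.Bool.Properties as Bool
open import Data.Empty using (⊥; ⊥-elim)
open import Data.Fin as Fin using (Fin; toℕ)
import Data.Fin.Properties as Fin
open import Data.Fin.Subset using (Subset; _∈_; _∉_; _⊆_; _∪_; ⁅_⁆; Nonempty)
open import Data.Fin.Subset.Properties
  using (_∈?_; nonempty?; x∈⁅x⁆; x∈⁅y⁆⇒x≡y; x∈p∪q⁻; p⊆p∪q; q⊆p∪q; ⊆-antisym)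
open import Data.List using (List; []; _∷_; [_]; length; map; filter; drop; replicate; cartesianProductWith)
import Data.List.Properties as List
open import Data.List.Membership.Propositional using () renaming (_∈_ to _∈ₗ_)
open import Data.List.Membership.Propositional.Properties using (∈-filter⁺; ∈-filter⁻; ∈-cartesianProductWith⁺)
open import Data.List.Relation.Binary.Pointwise using (Pointwise; []; _∷_)
open import Data.List.Relation.Unary.All as All using (All; []; _∷_; universal)
open import Data.List.Relation.Unary.All.Properties using (map⁺; replicate⁺)
open import Data.List.Relation.Unary.AllPairs using ([]; _∷_)
open import Data.List.Relation.Unary.Any using (here; there)
open import Data.List.Relation.Unary.Linked using (Linked; [-]; _∷_)
open import Data.List.Relation.Unary.Unique.Propositional using (Unique)
import Data.List.Relation.Unary.Unique.Propositional.Properties as Unique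
open import Data.Maybe using (Maybe; just; nothing; _>>=_)
import Data.Maybe as Maybe
open import Data.Maybe.Properties using (just-injective)
open import Data.Nat using (ℕ; zero; suc; _+_; _*_; _∸_; _%_; _≤_; _<_; _>_; _≤ᵇ_; z≤n; s≤s)
open import Data.Nat.Induction using (<-wellFounded)
open import Data.Product using (∃; ∃-syntax; _×_; _,_; proj₁; proj₂)
open import Data.Product.Properties using (,-injective) renaming (≡-dec to ×-≡-dec)
open import Data.Product.Relation.Binary.Lex.Strict using (×-strictTotalOrder; ×-wellFounded)
open import Data.Sum using (_⊎_; inj₁; inj₂; [_,_]′)
open import Data.Unit using (⊤; tt)
open import Data.Vec using (Vec; []; _∷_; lookup; updateAt)
import Data.Vec.Properties as Vec
open import Function using (_∘_; const)
open import Function.Bundles using (_⇔_; mk⇔; Equivalence)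
import Function.Properties.Equivalence as ⇔
import Induction.WellFounded as WF
open import Level using (0ℓ)
open import Relation.Binary.Bundles using (StrictTotalOrder)
open import Relation.Binary.Definitions using (DecidableEquality; tri<; tri≈; tri>)
open import Relation.Binary.PropositionalEquality
  using (_≡_; _≢_; refl; sym; trans; cong; cong₂; subst; ≢-sym; module ≡-Reasoning)
open import Relation.Nullary using (¬_; Dec; yes; no; contradiction)
open import Relation.Nullary.Decidable using (_×-dec_; _→-dec_; ¬?; map′; decidable-stable)
open import Relation.Nullary.Reflects using (ofʸ; ofⁿ)
open import Relation.Unary using (Decidable)

private
  variable
    X Y : Set

Even : ℕ → Set
Even k = ∃[ m ] k ≡ 2 * m

even⇒odd-suc : ∀ {k} → Even k → Odd (suc k)
even⇒odd-suc (m , refl) = m , refl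

even⇒even-2+ : ∀ {k} → Even k → Even (suc (suc k))
even⇒even-2+ (m , refl) = suc m , cong suc (sym (+-suc m (m + 0)))

HasCard-cong : ∀ {P Q : X → Set} {k} → (∀ x → P x ⇔ Q x) → HasCard P k → HasCard Q k
HasCard-cong P⇔Q (L , unique , ∈⇔P , |L|≡k) = L , unique , (λ x → ⇔.trans (∈⇔P x) (P⇔Q x)) , |L|≡k

module _ (_≟ˣ_ : DecidableEquality X) (σ : X → X) where

  without : X → List X → List X
  without a = filter (λ z → ¬? (z ≟ˣ a))

  ∈-without⁻ : ∀ {a x} L → x ∈ₗ without a L → x ∈ₗ L × x ≢ a
  ∈-without⁻ {a} L = ∈-filter⁻ (λ z → ¬? (z ≟ˣ a)) {xs = L}

  ∈-without⁺ : ∀ {a x L} → x ∈ₗ L → x ≢ a → x ∈ₗ without a L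
  ∈-without⁺ {a} = ∈-filter⁺ (λ z → ¬? (z ≟ˣ a))

  length-without : ∀ {a} L → Unique L → a ∈ₗ L → length L ≡ suc (length (without a L))
  length-without {a} (z ∷ zs) (z∉zs ∷ u) a∈ with z ≟ˣ a | a∈
  ... | yes refl | _          = cong (suc ∘ length) (sym (List.filter-all _ (All.map ≢-sym z∉zs)))
  ... | no  z≢a  | here refl  = contradiction refl z≢a
  ... | no  _    | there a∈zs = cong suc (length-without zs u a∈zs)

  Closed Involutive FixpointFree : List X → Set
  Closed L       = ∀ {x} → x ∈ₗ L → σ x ∈ₗ L
  Involutive L   = ∀ {x} → x ∈ₗ L → σ (σ x) ≡ x
  FixpointFree L = ∀ {x} → x ∈ₗ L → σ x ≢ x

  fixpointFree-involution⇒even : ∀ k L → length L ≤ k → Unique L →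
    Closed L → Involutive L → FixpointFree L → Even (length L)
  fixpointFree-involution⇒even _       []      _          _          _      _     _    = 0 , refl
  fixpointFree-involution⇒even (suc k) (y ∷ L) (s≤s |L|≤k) (y∉L ∷ u) closed invol free =
    subst (Even ∘ suc) (sym |L|≡1+|L′|)
      (even⇒even-2+ (fixpointFree-involution⇒even k L′ |L′|≤k (Unique.filter⁺ _ u)
        closed′ (invol ∘ there ∘ ∈L) (free ∘ there ∘ ∈L)))
    where
      L′ : List X
      L′ = without (σ y) L
      ∈L : ∀ {x} → x ∈ₗ L′ → x ∈ₗ L
      ∈L = proj₁ ∘ ∈-without⁻ L
      σy∈L : σ y ∈ₗ L
      σy∈L with closed (here refl)
      ... | here σy≡y  = contradiction σy≡y (free (here refl))
      ... | there σy∈L = σy∈L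
      |L|≡1+|L′| : length L ≡ suc (length L′)
      |L|≡1+|L′| = length-without L u σy∈L
      |L′|≤k : length L′ ≤ k
      |L′|≤k = ≤-trans (n≤1+n _) (subst (_≤ k) |L|≡1+|L′| |L|≤k)
      ≢y : ∀ {x} → x ∈ₗ L → x ≢ y
      ≢y x∈L refl = All.lookup y∉L x∈L refl
      closed′ : Closed L′
      closed′ {x} x∈L′ with ∈-without⁻ L x∈L′
      ... | x∈L , x≢σy with closed (there x∈L)
      ... | here σx≡y  = contradiction (trans (sym (invol (there x∈L))) (cong σ σx≡y)) x≢σy
      ... | there σx∈L = ∈-without⁺ σx∈L λ σx≡σy →
              ≢y x∈L (trans (sym (invol (there x∈L))) (trans (cong σ σx≡σy) (invol (here refl))))

  involution-with-unique-fixpoint⇒odd : ∀ {P : X → Set} {k} → HasCard P k →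
    (∀ {x} → P x → P (σ x)) → (∀ {x} → P x → σ (σ x) ≡ x) →
    ∀ {x₀} → P x₀ → σ x₀ ≡ x₀ → (∀ {x} → P x → σ x ≡ x → x ≡ x₀) → Odd k
  involution-with-unique-fixpoint⇒odd {P} (L , u , ∈⇔P , refl) closed invol {x₀} Px₀ σx₀≡x₀ unique =
    subst Odd (sym (length-without L u (Equivalence.from (∈⇔P x₀) Px₀)))
      (even⇒odd-suc (fixpointFree-involution⇒even _ L′ ≤-refl (Unique.filter⁺ _ u)
        closed′ (invol ∘ P-of) free))
    where
      L′ : List X
      L′ = without x₀ L
      P-of : ∀ {x} → x ∈ₗ L′ → P x
      P-of {x} = Equivalence.to (∈⇔P x) ∘ proj₁ ∘ ∈-without⁻ L
      closed′ : Closed L′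
      closed′ {x} x∈L′ = ∈-without⁺ (Equivalence.from (∈⇔P (σ x)) (closed (P-of x∈L′))) λ σx≡x₀ →
        proj₂ (∈-without⁻ L x∈L′) (trans (sym (invol (P-of x∈L′))) (trans (cong σ σx≡x₀) σx₀≡x₀))
      free : FixpointFree L′
      free x∈L′ σx≡x = proj₂ (∈-without⁻ L x∈L′) (unique (P-of x∈L′) σx≡x)

Least : ∀ {m} → (Fin m → Set) → Fin m → Set
Least P x = P x × (∀ {y} → y Fin.< x → ¬ P y)

least? : ∀ {m} {P : Fin m → Set} → Decidable P → ∃ (Least P) ⊎ (∀ x → ¬ P x)
least? {zero}  P? = inj₂ λ ()
least? {suc m} P? with P? Fin.zero | least? (P? ∘ Fin.suc)
... | yes P0 | _                    = inj₁ (Fin.zero , P0 , λ ())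
... | no ¬P0 | inj₁ (x , Psx , below) =
      inj₁ (Fin.suc x , Psx , λ { {Fin.zero} _ → ¬P0 ; {Fin.suc y} (s≤s y<x) → below y<x })
... | no ¬P0 | inj₂ none            = inj₂ λ { Fin.zero → ¬P0 ; (Fin.suc x) → none x }

least-unique : ∀ {m} {P : Fin m → Set} {x y} → Least P x → Least P y → x ≡ y
least-unique {x = x} {y} (Px , x-least) (Py , y-least) with Fin.<-cmp x y
... | tri< x<y _ _ = contradiction Px (y-least x<y)
... | tri≈ _ x≡y _ = x≡y
... | tri> _ _ y<x = contradiction Py (x-least y<x)

module Lex = StrictTotalOrder (×-strictTotalOrder <-strictTotalOrder <-strictTotalOrder)

_≺_ : ℕ × ℕ → ℕ × ℕ → Set
_≺_ = Lex._<_

≺-wellFounded : WF.WellFounded _≺_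
≺-wellFounded = ×-wellFounded <-wellFounded <-wellFounded

≺-irrefl : ∀ {p} → ¬ p ≺ p
≺-irrefl = Lex.irrefl (refl , refl)

≺⇒≢ : ∀ {p q} → p ≺ q → p ≢ q
≺⇒≢ p≺q refl = ≺-irrefl p≺q

≺-suc⁻ : ∀ {i j i′ j′} → (i′ , j′) ≺ (i , suc j) →
  (i′ , j′) ≺ (i , j) ⊎ (i′ , j′) ≡ (i , j)
≺-suc⁻ (inj₁ i′<i) = inj₁ (inj₁ i′<i)
≺-suc⁻ (inj₂ (refl , j′<1+j)) with m≤n⇒m<n∨m≡n (≤-pred j′<1+j)
... | inj₁ j′<j = inj₁ (inj₂ (refl , j′<j))
... | inj₂ refl = inj₂ refl

LeastBelow : ℕ → (ℕ → Set) → ℕ → Set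
LeastBelow K P k = k < K × P k × (∀ {k′} → k′ < k → ¬ P k′)

leastBelow? : ∀ K {P : ℕ → Set} → Decidable P → ∃ (LeastBelow K P) ⊎ (∀ {k} → k < K → ¬ P k)
leastBelow? zero    P? = inj₂ λ ()
leastBelow? (suc K) P? with leastBelow? K P?
... | inj₁ (k , k<K , Pk , least) = inj₁ (k , m<n⇒m<1+n k<K , Pk , least)
... | inj₂ none with P? K
...   | yes PK = inj₁ (K , ≤-refl , PK , none)
...   | no ¬PK = inj₂ λ k<1+K → [ none , (λ { refl → ¬PK }) ]′ (m≤n⇒m<n∨m≡n (≤-pred k<1+K))

LexLeastBelow : ℕ → ℕ → (ℕ → ℕ → Set) → ℕ × ℕ → Set
LexLeastBelow I J P (i , j) =
  i < I × j < J × P i j × (∀ {i′ j′} → (i′ , j′) ≺ (i , j) → i′ < I → j′ < J → ¬ P i′ j′)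

lexLeastBelow? : ∀ I J {P : ℕ → ℕ → Set} → (∀ i j → Dec (P i j)) →
  ∃ (LexLeastBelow I J P) ⊎ (∀ {i j} → i < I → j < J → ¬ P i j)
lexLeastBelow? I J {P} P? with leastBelow? I (λ i → anyUpTo? (P? i) J)
... | inj₂ none = inj₂ λ i<I j<J Pij → none i<I (_ , j<J , Pij)
... | inj₁ (i , i<I , (j₀ , j₀<J , Pij₀) , row-least) with leastBelow? J (P? i)
...   | inj₂ none = contradiction Pij₀ (none j₀<J)
...   | inj₁ (j , j<J , Pij , column-least) = inj₁ ((i , j) , i<I , j<J , Pij , earlier)
  where
    earlier : ∀ {i′ j′} → (i′ , j′) ≺ (i , j) → i′ < I → j′ < J → ¬ P i′ j′
    earlier (inj₁ i′<i)          _ j′<J Pi′j′ = row-least i′<i (_ , j′<J , Pi′j′)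
    earlier (inj₂ (refl , j′<j)) _ _    Pij′  = column-least j′<j Pij′

∀ℕ? : ∀ {P : ℕ → Set} K → (∀ k → Dec (P k)) → (∀ {k} → K ≤ k → P k) → Dec (∀ {k} → P k)
∀ℕ? {P} K P? beyond = map′ extend (λ all _ → all) (allUpTo? P? K)
  where
    extend : (∀ {k} → k < K → P k) → ∀ {k} → P k
    extend below {k} with k <? K
    ... | yes k<K = below k<K
    ... | no  k≮K = beyond (≮⇒≥ k≮K)

∀Fin? : ∀ {m} {P : Fin m → Set} → (∀ x → Dec (P x)) → Dec (∀ {x} → P x)
∀Fin? P? = map′ (λ all {x} → all x) (λ all x → all) (Fin.all? P?)

∀-just? : ∀ {Q : X → Set} (m : Maybe X) → (∀ x → Dec (Q x)) → Dec (∀ {x} → m ≡ just x → Q x)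
∀-just? nothing  _  = yes λ ()
∀-just? (just x) Q? = map′ (λ { q refl → q }) (λ all → all refl) (Q? x)

vectors : List X → ∀ m → List (Vec X m)
vectors xs zero    = [ [] ]
vectors xs (suc m) = cartesianProductWith _∷_ xs (vectors xs m)

vectors-unique : ∀ {xs : List X} → Unique xs → ∀ m → Unique (vectors xs m)
vectors-unique u zero    = [] ∷ []
vectors-unique u (suc m) = Unique.cartesianProductWith⁺ _∷_ Vec.∷-injective u (vectors-unique u m)

∈-vectors : ∀ {xs : List X} → (∀ x → x ∈ₗ xs) → ∀ {m} (v : Vec X m) → v ∈ₗ vectors xs m
∈-vectors complete []      = here refl
∈-vectors complete (x ∷ v) = ∈-cartesianProductWith⁺ _∷_ (complete x) (∈-vectors complete v)

subsets : ∀ m → List (Subset m)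
subsets = vectors (true ∷ false ∷ [])

subsets-unique : ∀ m → Unique (subsets m)
subsets-unique = vectors-unique (((λ ()) ∷ []) ∷ [] ∷ [])

∈-subsets : ∀ {m} (A : Subset m) → A ∈ₗ subsets m
∈-subsets = ∈-vectors λ { true → here refl ; false → there (here refl) }

products : List (List X) → List (List X)
products []         = [ [] ]
products (xs ∷ xss) = cartesianProductWith _∷_ xs (products xss)

products-unique : ∀ {xss : List (List X)} → All Unique xss → Unique (products xss)
products-unique []       = [] ∷ []
products-unique (u ∷ us) = Unique.cartesianProductWith⁺ _∷_ List.∷-injective u (products-unique us)

∈-products : ∀ {ys : List X} {xss} → Pointwise _∈ₗ_ ys xss → ys ∈ₗ products xss
∈-products []         = here refl
∈-products (y∈ ∷ ys∈) = ∈-cartesianProductWith⁺ _∷_ y∈ (∈-products ys∈)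

∈-replicate : ∀ {xs : List X} → (∀ x → x ∈ₗ xs) → ∀ ys →
  Pointwise _∈ₗ_ ys (replicate (length ys) xs)
∈-replicate complete []       = []
∈-replicate complete (y ∷ ys) = complete y ∷ ∈-replicate complete ys

modifyAt : List X → ℕ → (X → X) → List X
modifyAt []       _       f = []
modifyAt (x ∷ xs) zero    f = f x ∷ xs
modifyAt (x ∷ xs) (suc k) f = x ∷ modifyAt xs k f

lookup₂ : List (List X) → ℕ → ℕ → Maybe X
lookup₂ F r k = F !? r >>= _!? k

modifyAt₂ : List (List X) → ℕ → ℕ → (X → X) → List (List X)
modifyAt₂ F r k f = modifyAt F r (λ row → modifyAt row k f)

modifyAt-same : ∀ (xs : List X) k f → modifyAt xs k f !? k ≡ Maybe.map f (xs !? k)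
modifyAt-same []       k       f = refl
modifyAt-same (x ∷ xs) zero    f = refl
modifyAt-same (x ∷ xs) (suc k) f = modifyAt-same xs k f

modifyAt-other : ∀ (xs : List X) {k k′} f → k ≢ k′ → modifyAt xs k f !? k′ ≡ xs !? k′
modifyAt-other []       {_}     {_}      f _    = refl
modifyAt-other (x ∷ xs) {zero}  {zero}   f k≢k′ = contradiction refl k≢k′
modifyAt-other (x ∷ xs) {zero}  {suc _}  f _    = refl
modifyAt-other (x ∷ xs) {suc _} {zero}   f _    = refl
modifyAt-other (x ∷ xs) {suc _} {suc _}  f k≢k′ = modifyAt-other xs f (k≢k′ ∘ cong suc)

length-modifyAt : ∀ (xs : List X) k f → length (modifyAt xs k f) ≡ length xs
length-modifyAt []       k       f = refl
length-modifyAt (x ∷ xs) zero    f = refl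
length-modifyAt (x ∷ xs) (suc k) f = cong suc (length-modifyAt xs k f)

map-modifyAt : ∀ (h : X → Y) (xs : List X) k {f} → (∀ a → h (f a) ≡ h a) →
  map h (modifyAt xs k f) ≡ map h xs
map-modifyAt h []       k       hf≗h = refl
map-modifyAt h (x ∷ xs) zero    hf≗h = cong (_∷ map h xs) (hf≗h x)
map-modifyAt h (x ∷ xs) (suc k) hf≗h = cong (h x ∷_) (map-modifyAt h xs k hf≗h)

modifyAt-involutive : ∀ (xs : List X) k {f} → (∀ a → f (f a) ≡ a) → modifyAt (modifyAt xs k f) k f ≡ xs
modifyAt-involutive []       k       ff≗id = refl
modifyAt-involutive (x ∷ xs) zero    ff≗id = cong (_∷ xs) (ff≗id x)
modifyAt-involutive (x ∷ xs) (suc k) ff≗id = cong (x ∷_) (modifyAt-involutive xs k ff≗id)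

!?-just⇒< : ∀ (xs : List X) k {a} → xs !? k ≡ just a → k < length xs
!?-just⇒< (x ∷ xs) zero    _ = s≤s z≤n
!?-just⇒< (x ∷ xs) (suc k) e = s≤s (!?-just⇒< xs k e)

<⇒!?-just : ∀ (xs : List X) k → k < length xs → ∃[ a ] xs !? k ≡ just a
<⇒!?-just (x ∷ xs) zero    _         = x , refl
<⇒!?-just (x ∷ xs) (suc k) (s≤s k<n) = <⇒!?-just xs k k<n

!?-ext : ∀ (xs ys : List X) → (∀ k → xs !? k ≡ ys !? k) → xs ≡ ys
!?-ext []       []       _  = refl
!?-ext []       (y ∷ ys) eq with () ← eq 0
!?-ext (x ∷ xs) []       eq with () ← eq 0
!?-ext (x ∷ xs) (y ∷ ys) eq = cong₂ _∷_ (just-injective (eq 0)) (!?-ext xs ys (eq ∘ suc))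

lookup₂-just : ∀ (F : List (List X)) r {k a} → lookup₂ F r k ≡ just a →
  ∃[ row ] (F !? r ≡ just row × row !? k ≡ just a)
lookup₂-just F r eq with F !? r
... | just row = row , refl , eq

lookup₂-modifyAt₂-same : ∀ (F : List (List X)) r k f →
  lookup₂ (modifyAt₂ F r k f) r k ≡ Maybe.map f (lookup₂ F r k)
lookup₂-modifyAt₂-same F r k f rewrite modifyAt-same F r (λ row → modifyAt row k f) with F !? r
... | nothing  = refl
... | just row = modifyAt-same row k f

lookup₂-modifyAt₂-other : ∀ (F : List (List X)) {r k r′ k′} f → (r , k) ≢ (r′ , k′) →
  lookup₂ (modifyAt₂ F r k f) r′ k′ ≡ lookup₂ F r′ k′
lookup₂-modifyAt₂-other F {r} {k} {r′} {k′} f rk≢ with r ≟ r′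
... | no r≢r′ = cong (_>>= _!? k′) (modifyAt-other F _ r≢r′)
... | yes refl rewrite modifyAt-same F r (λ row → modifyAt row k f) with F !? r
...   | nothing  = refl
...   | just row = modifyAt-other row f (rk≢ ∘ cong (r ,_))

modifyAt₂-involutive : ∀ (F : List (List X)) r k {f} → (∀ a → f (f a) ≡ a) →
  modifyAt₂ (modifyAt₂ F r k f) r k f ≡ F
modifyAt₂-involutive F r k ff≗id = modifyAt-involutive F r (λ row → modifyAt-involutive row k ff≗id)

map-length-modifyAt₂ : ∀ (F : List (List X)) r k f → map length (modifyAt₂ F r k f) ≡ map length F
map-length-modifyAt₂ F r k f = map-modifyAt length F r (λ row → length-modifyAt row k f)

lookup₂-ext : ∀ (F G : List (List X)) → length F ≡ length G →
  (∀ r k → lookup₂ F r k ≡ lookup₂ G r k) → F ≡ G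
lookup₂-ext []        []        _   _  = refl
lookup₂-ext (row ∷ F) (row′ ∷ G) |F|≡ eq =
  cong₂ _∷_ (!?-ext row row′ (eq 0)) (lookup₂-ext F G (suc-injective |F|≡) (eq ∘ suc))

offset : Partition → ℕ → ℕ
offset mu r = part mu r + suc r

-- Box rows i are counted from 1 as in Defs.box, parts from 0: row suc r is governed by part _ r.
IsBox : Partition → Partition → ℕ → ℕ → Set
IsBox la mu zero    j = ⊥
IsBox la mu (suc r) j = r < length la × offset mu r ≤ j × j < offset la r

part-step : ∀ {xs} → Linked _>_ xs → ∀ {s} → suc s < length xs → part xs (suc s) < part xs s
part-step [-]       {zero}  (s≤s ())
part-step (x>y ∷ _) {zero}  _         = x>y
part-step (_ ∷ l)   {suc s} (s≤s s<ℓ) = part-step l s<ℓ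

offset-antitone : ∀ {xs} → Linked _>_ xs → ∀ {r s} → r ≤ s → s < length xs → offset xs s ≤ offset xs r
offset-antitone {xs} l {r} {s} r≤s s<ℓ with m≤n⇒m<n∨m≡n r≤s
... | inj₂ refl              = ≤-refl
... | inj₁ (s≤s {n = s′} r≤s′) = begin
  part xs (suc s′) + suc (suc s′) ≡⟨ +-suc _ (suc s′) ⟩
  suc (part xs (suc s′)) + suc s′ ≤⟨ +-monoˡ-≤ (suc s′) (part-step l s<ℓ) ⟩
  offset xs s′                    ≤⟨ offset-antitone l r≤s′ (<⇒≤ s<ℓ) ⟩
  offset xs r                     ∎
  where open ≤-Reasoning

part-pos⇒< : ∀ xs {s} → 0 < part xs s → s < length xs
part-pos⇒< (x ∷ xs) {zero}  _   = s≤s z≤n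
part-pos⇒< (x ∷ xs) {suc s} pos = s≤s (part-pos⇒< xs pos)

IsBox-row-between : ∀ {la mu i j j′ j″} → IsBox la mu i j → IsBox la mu i j″ →
  j ≤ j′ → j′ ≤ j″ → IsBox la mu i j′
IsBox-row-between {i = suc r} (r<ℓ , o≤j , _) (_ , _ , j″<) j≤j′ j′≤j″ =
  r<ℓ , ≤-trans o≤j j≤j′ , ≤-<-trans j′≤j″ j″<

IsBox-column-between : ∀ {la mu i i′ i″ j} → Strict la → Strict mu →
  IsBox la mu i j → IsBox la mu i″ j → i ≤ i′ → i′ ≤ i″ → IsBox la mu i′ j
IsBox-column-between {la} {mu} {suc r} {suc r′} {suc r″} {j} (la-dec , _) (mu-dec , _)
  (_ , o≤j , _) (r″<ℓ , o″≤j , j<) (s≤s r≤r′) (s≤s r′≤r″) =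
  ≤-<-trans r′≤r″ r″<ℓ ,
  mu-offset≤ (part mu r′) refl ,
  <-≤-trans j< (offset-antitone la-dec r′≤r″ r″<ℓ)
  where
    mu-offset≤ : ∀ p → part mu r′ ≡ p → offset mu r′ ≤ j
    mu-offset≤ zero    μr′≡0 = begin
      part mu r′ + suc r′ ≡⟨ cong (_+ suc r′) μr′≡0 ⟩
      suc r′              ≤⟨ s≤s r′≤r″ ⟩
      suc r″              ≤⟨ m≤n+m (suc r″) (part mu r″) ⟩
      offset mu r″        ≤⟨ o″≤j ⟩
      j                   ∎
      where open ≤-Reasoning
    mu-offset≤ (suc _) μr′≡1+ =
      ≤-trans (offset-antitone mu-dec r≤r′ (part-pos⇒< mu (subst (0 <_) (sym μr′≡1+) (s≤s z≤n)))) o≤j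

<∸⇒+< : ∀ m {k a} → k < a ∸ m → m + k < a
<∸⇒+< zero    k<a = k<a
<∸⇒+< (suc m) {a = suc a} k<a∸m = s≤s (<∸⇒+< m k<a∸m)

+<⇒<∸ : ∀ m {k a} → m + k < a → k < a ∸ m
+<⇒<∸ zero    m+k<a = m+k<a
+<⇒<∸ (suc m) {a = suc a} (s≤s m+k<a) = +<⇒<∸ m m+k<a

offset-<⇔ : ∀ la mu r {j} → offset mu r ≤ j →
  (j < offset la r ⇔ j ∸ offset mu r < part la r ∸ part mu r)
offset-<⇔ la mu r {j} o≤j = mk⇔
  (λ j< → +<⇒<∸ (part mu r) (+-cancelʳ-< (suc r) _ _ (subst (_< offset la r) (sym j≡) j<)))
  (λ k< → subst (_< offset la r) j≡ (+-monoˡ-< (suc r) (<∸⇒+< (part mu r) k<)))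
  where
    j≡ : part mu r + (j ∸ offset mu r) + suc r ≡ j
    j≡ = trans (xy∙z≈xz∙y (part mu r) _ (suc r)) (m+[n∸m]≡n o≤j)

rowLengths : Partition → Partition → List ℕ
rowLengths []       mu = []
rowLengths (l ∷ la) mu = (l ∸ part mu 0) ∷ rowLengths la (drop 1 mu)

part-drop-1 : ∀ mu r → part (drop 1 mu) r ≡ part mu (suc r)
part-drop-1 []       r = refl
part-drop-1 (m ∷ mu) r = refl

toggle : ∀ {m} → Fin m → Subset m → Subset m
toggle x A = updateAt A x not

module _ {m} {x : Fin m} {A : Subset m} where

  toggle-involutive : toggle x (toggle x A) ≡ A
  toggle-involutive = trans (Vec.updateAt-updateAt x A) (Vec.updateAt-id-local x A (Bool.not-involutive _))

  toggle-≢ : toggle x A ≢ A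
  toggle-≢ eq = Bool.not-¬ refl (sym (trans (sym (Vec.lookup∘updateAt x A)) (cong (λ B → lookup B x) eq)))

  ∈-toggle⁺ : ∀ {y} → y ≢ x → y ∈ A → y ∈ toggle x A
  ∈-toggle⁺ {y} = Vec.updateAt-minimal y x A

  ∈-toggle⁻ : ∀ {y} → y ≢ x → y ∈ toggle x A → y ∈ A
  ∈-toggle⁻ {y} y≢x y∈ = subst (y ∈_) toggle-involutive (Vec.updateAt-minimal y x (toggle x A) y≢x y∈)

  ∈⇒∉-toggle : x ∈ A → x ∉ toggle x A
  ∈⇒∉-toggle x∈A x∈tA with () ← Vec.[]=-injective (Vec.updateAt-updates x A x∈A) x∈tA

  ∉⇒∈-toggle : x ∉ A → x ∈ toggle x A
  ∉⇒∈-toggle x∉A with lookup A x in eq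
  ... | true  = contradiction (Vec.lookup⇒[]= x A eq) x∉A
  ... | false = Vec.updateAt-updates x A (Vec.lookup⇒[]= x A eq)

  toggle-⊆ : toggle x A ⊆ A ∪ ⁅ x ⁆
  toggle-⊆ {t} t∈ with t Fin.≟ x
  ... | yes refl = q⊆p∪q A ⁅ x ⁆ (x∈⁅x⁆ x)
  ... | no  t≢x  = p⊆p∪q ⁅ x ⁆ (∈-toggle⁻ t≢x t∈)

  toggle-nonempty : A ≢ ⁅ x ⁆ → Nonempty (toggle x A)
  toggle-nonempty A≢⁅x⁆ with x ∈? A
  ... | no  x∉A = x , ∉⇒∈-toggle x∉A
  ... | yes x∈A with Fin.any? (λ y → (y ∈? A) ×-dec ¬? (y Fin.≟ x))
  ...   | yes (y , y∈A , y≢x) = y , ∈-toggle⁺ y≢x y∈A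
  ...   | no  ∄y = contradiction (⊆-antisym A⊆⁅x⁆ ⁅x⁆⊆A) A≢⁅x⁆
    where
      A⊆⁅x⁆ : A ⊆ ⁅ x ⁆
      A⊆⁅x⁆ {y} y∈A with y Fin.≟ x
      ... | yes refl = x∈⁅x⁆ x
      ... | no  y≢x  = contradiction (y , y∈A , y≢x) ∄y
      ⁅x⁆⊆A : ⁅ x ⁆ ⊆ A
      ⁅x⁆⊆A y∈⁅x⁆ = subst (_∈ A) (sym (x∈⁅y⁆⇒x≡y x y∈⁅x⁆)) x∈A

  toggle-≢-⁅⁆ : Nonempty A → toggle x A ≢ ⁅ x ⁆
  toggle-≢-⁅⁆ (a , a∈A) eq with x ∈? A
  ... | yes x∈A = ∈⇒∉-toggle x∈A (subst (x ∈_) (sym eq) (x∈⁅x⁆ x))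
  ... | no  x∉A with a Fin.≟ x
  ...   | yes refl = x∉A a∈A
  ...   | no  a≢x  = a≢x (x∈⁅y⁆⇒x≡y x (subst (a ∈_) eq (∈-toggle⁺ a≢x a∈A)))

_≼?_ : ∀ {m} (A B : Subset m) → Dec (A ≼ B)
A ≼? B = Fin.all? λ a → Fin.all? λ b → (a ∈? A) →-dec ((b ∈? B) →-dec (a Fin.≤? b))

≼-⁅⁆ : ∀ {m} {A B : Subset m} {b} → A ≼ B → b ∈ B → A ≼ ⁅ b ⁆
≼-⁅⁆ {b = b} A≼B b∈B a c a∈A c∈⁅b⁆ rewrite x∈⁅y⁆⇒x≡y b c∈⁅b⁆ = A≼B a b a∈A b∈B

≼-trans : ∀ {m} {A M C : Subset m} → Nonempty M → A ≼ M → M ≼ C → A ≼ C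
≼-trans (m , m∈M) A≼M M≼C a c a∈A c∈C = Fin.≤-trans (A≼M a m a∈A m∈M) (M≼C m c m∈M c∈C)

module Fillings {n : ℕ} where

  Board : Set
  Board = ℕ → ℕ → Maybe (Subset (2 * n))

  unprimed? : (t : Letter n) → Dec (Unprimed {n} t)
  unprimed? t = toℕ t % 2 ≟ 1

  primed? : (t : Letter n) → Dec (Primed {n} t)
  primed? t = toℕ t % 2 ≟ 0

  -- Opaque, unlike box, so that the position (i , j) in board mu F i j ≡ just A can be inferred.
  opaque
    board : Partition → Filling n → Board
    board = box {n}

    board≡box : board ≡ box {n}
    board≡box = refl

    board-zero : ∀ mu F j → board mu F zero j ≡ nothing
    board-zero mu F j = refl

    board-inside : ∀ mu F r {j} → offset mu r ≤ j → board mu F (suc r) j ≡ lookup₂ F r (j ∸ offset mu r)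
    board-inside mu F r {j} o≤j with part mu r + suc r ≤ᵇ j | ≤ᵇ-reflects-≤ (part mu r + suc r) j
    ... | true  | _        = refl
    ... | false | ofⁿ o≰j = contradiction o≤j o≰j

    board-outside : ∀ mu F r {j} → ¬ offset mu r ≤ j → board mu F (suc r) j ≡ nothing
    board-outside mu F r {j} o≰j with part mu r + suc r ≤ᵇ j | ≤ᵇ-reflects-≤ (part mu r + suc r) j
    ... | true  | ofʸ o≤j = contradiction o≤j o≰j
    ... | false | _        = refl

  board-just : ∀ mu F r {j A} → board mu F (suc r) j ≡ just A →
    offset mu r ≤ j × lookup₂ F r (j ∸ offset mu r) ≡ just A
  board-just mu F r {j} eq with offset mu r ≤? j
  ... | yes o≤j = o≤j , trans (sym (board-inside mu F r o≤j)) eq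
  ... | no  o≰j with () ← trans (sym eq) (board-outside mu F r o≰j)

  board-offset : ∀ mu F r k → board mu F (suc r) (offset mu r + k) ≡ lookup₂ F r k
  board-offset mu F r k = trans (board-inside mu F r (m≤m+n _ k)) (cong (lookup₂ F r) (m+n∸m≡n (offset mu r) k))

  module _ (la mu : Partition) (F : Filling n) (shape : HasShape {n} la mu F) where

    board-just⇒IsBox : ∀ {i j A} → board mu F i j ≡ just A → IsBox la mu i j
    board-just⇒IsBox {zero}  eq with () ← trans (sym eq) (board-zero mu F _)
    board-just⇒IsBox {suc r} eq with board-just mu F r eq
    ... | o≤j , lk with lookup₂-just F r lk
    ...   | row , F!?r , row!?k =
            subst (r <_) (proj₁ shape) (!?-just⇒< F r F!?r) , o≤j ,
            Equivalence.from (offset-<⇔ la mu r o≤j)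
              (subst (_ <_) (proj₂ shape r row F!?r) (!?-just⇒< row _ row!?k))

    IsBox⇒board-just : ∀ {i j} → IsBox la mu i j → ∃[ A ] board mu F i j ≡ just A
    IsBox⇒board-just {suc r} {j} (r<ℓ , o≤j , j<) with <⇒!?-just F r (subst (r <_) (sym (proj₁ shape)) r<ℓ)
    ... | row , F!?r with <⇒!?-just row (j ∸ offset mu r)
                            (subst (_ <_) (sym (proj₂ shape r row F!?r)) (Equivalence.to (offset-<⇔ la mu r o≤j) j<))
    ...   | A , row!?k = A , trans (board-inside mu F r o≤j) (trans (cong (_>>= _!? _) F!?r) row!?k)

  HasShape⇒rowLengths : ∀ la mu (F : Filling n) → HasShape {n} la mu F → map length F ≡ rowLengths la mu
  HasShape⇒rowLengths []       mu []        _              = refl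
  HasShape⇒rowLengths (l ∷ la) mu (row ∷ F) (|F|≡ , |rows|) =
    cong₂ _∷_ (|rows| 0 row refl) (HasShape⇒rowLengths la (drop 1 mu) F (suc-injective |F|≡ , |rows|′))
    where
      |rows|′ : ∀ r row′ → F !? r ≡ just row′ → length row′ ≡ part la r ∸ part (drop 1 mu) r
      |rows|′ r row′ eq = trans (|rows| (suc r) row′ eq) (cong (part la r ∸_) (sym (part-drop-1 mu r)))

  rowLengths⇒HasShape : ∀ la mu (F : Filling n) → map length F ≡ rowLengths la mu → HasShape {n} la mu F
  rowLengths⇒HasShape []       mu []        _  = refl , λ _ _ ()
  rowLengths⇒HasShape (l ∷ la) mu (row ∷ F) eq with List.∷-injective eq
  ... | |row|≡ , rest with rowLengths⇒HasShape la (drop 1 mu) F rest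
  ...   | |F|≡ , |rows| = cong suc |F|≡ , |rows|′
    where
      |rows|′ : ∀ r row′ → (row ∷ F) !? r ≡ just row′ → length row′ ≡ part (l ∷ la) r ∸ part mu r
      |rows|′ zero    _    refl = |row|≡
      |rows|′ (suc r) row′ eq   = trans (|rows| r row′ eq) (cong (part la r ∸_) (part-drop-1 mu r))

  updateBox : Partition → Filling n → ℕ → ℕ → (Subset (2 * n) → Subset (2 * n)) → Filling n
  updateBox mu F zero    j f = F
  updateBox mu F (suc r) j f = modifyAt₂ F r (j ∸ offset mu r) f

  updateBox-HasShape : ∀ la mu F i j f → HasShape {n} la mu F → HasShape {n} la mu (updateBox mu F i j f)
  updateBox-HasShape la mu F zero    j f shape = shape
  updateBox-HasShape la mu F (suc r) j f shape = rowLengths⇒HasShape la mu _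
    (trans (map-length-modifyAt₂ F r _ f) (HasShape⇒rowLengths la mu F shape))

  updateBox-involutive : ∀ mu F i j {f} → (∀ A → f (f A) ≡ A) → updateBox mu (updateBox mu F i j f) i j f ≡ F
  updateBox-involutive mu F zero    j ff≗id = refl
  updateBox-involutive mu F (suc r) j ff≗id = modifyAt₂-involutive F r _ ff≗id

  board-updateBox-same : ∀ mu F {i j A} f → board mu F i j ≡ just A →
    board mu (updateBox mu F i j f) i j ≡ just (f A)
  board-updateBox-same mu F {zero}  f eq with () ← trans (sym eq) (board-zero mu F _)
  board-updateBox-same mu F {suc r} f eq with board-just mu F r eq
  ... | o≤j , lk = trans (board-inside mu (modifyAt₂ F r _ f) r o≤j)
                      (trans (lookup₂-modifyAt₂-same F r _ f) (cong (Maybe.map f) lk))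

  board-updateBox-other : ∀ mu F {i j A} f → board mu F i j ≡ just A →
    ∀ {i′ j′} → (i′ , j′) ≢ (i , j) → board mu (updateBox mu F i j f) i′ j′ ≡ board mu F i′ j′
  board-updateBox-other mu F {zero}  f eq with () ← trans (sym eq) (board-zero mu F _)
  board-updateBox-other mu F {suc r} f eq {zero}        _ = trans (board-zero mu _ _) (sym (board-zero mu F _))
  board-updateBox-other mu F {suc r} {j} f eq {suc r′} {j′} ne with offset mu r′ ≤? j′
  ... | no  o′≰j′ = trans (board-outside mu _ r′ o′≰j′) (sym (board-outside mu F r′ o′≰j′))
  ... | yes o′≤j′ = begin
    board mu F′ (suc r′) j′           ≡⟨ board-inside mu F′ r′ o′≤j′ ⟩
    lookup₂ F′ r′ (j′ ∸ offset mu r′) ≡⟨ lookup₂-modifyAt₂-other F f (ne ∘ same-box) ⟩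
    lookup₂ F r′ (j′ ∸ offset mu r′)  ≡⟨ board-inside mu F r′ o′≤j′ ⟨
    board mu F (suc r′) j′            ∎
    where
      open ≡-Reasoning
      F′ : Filling n
      F′ = modifyAt₂ F r (j ∸ offset mu r) f
      same-box : (r , j ∸ offset mu r) ≡ (r′ , j′ ∸ offset mu r′) → (suc r′ , j′) ≡ (suc r , j)
      same-box eq′ with ,-injective eq′
      ... | refl , k≡k′ = cong (suc r ,_) (begin
        j′                               ≡⟨ m+[n∸m]≡n o′≤j′ ⟨
        offset mu r + (j′ ∸ offset mu r) ≡⟨ cong (offset mu r +_) k≡k′ ⟨
        offset mu r + (j ∸ offset mu r)  ≡⟨ m+[n∸m]≡n (proj₁ (board-just mu F r eq)) ⟩
        j                                ∎)

  board-ext : ∀ la mu (F G : Filling n) → HasShape {n} la mu F → HasShape {n} la mu G →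
    (∀ i j → board mu F i j ≡ board mu G i j) → F ≡ G
  board-ext la mu F G shF shG eq = lookup₂-ext F G (trans (proj₁ shF) (sym (proj₁ shG))) λ r k →
    trans (sym (board-offset mu F r k)) (trans (eq (suc r) _) (board-offset mu G r k))

  -- Condition (4) is abstracted as Allowed i j t (letter t may occur in box (i , j)),
  -- so that P- and Q-tableaux are handled at once.
  module Tableaux (Allowed : ℕ → ℕ → Letter n → Set) (allowed? : ∀ i j t → Dec (Allowed i j t)) where

    record IsTableau (b : Board) : Set where
      field
        nonempty : ∀ {i j A} → b i j ≡ just A → Nonempty A
        rows-weak : ∀ {i j A} → b i j ≡ just A → ∀ {B} → b i (suc j) ≡ just B → A ≼ B
        columns-weak : ∀ {i j A} → b i j ≡ just A → ∀ {B} → b (suc i) j ≡ just B → A ≼ B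
        unprimed-once-per-column : ∀ {i j A} → b i j ≡ just A →
          ∀ {i′} → i < i′ → ∀ {B} → b i′ j ≡ just B → ∀ {t} → Unprimed {n} t → t ∈ A → t ∉ B
        primed-once-per-row : ∀ {i j A} → b i j ≡ just A →
          ∀ {j′} → j < j′ → ∀ {B} → b i j′ ≡ just B → ∀ {t} → Primed {n} t → t ∈ A → t ∉ B
        allowed : ∀ {i j A} → b i j ≡ just A → ∀ {t} → t ∈ A → Allowed i j t

    left above : Board → ℕ → ℕ → Maybe (Subset (2 * n))
    left  b i zero    = nothing
    left  b i (suc j) = b i j
    above b zero    j = nothing
    above b (suc i) j = b i j

    -- x may fill box (i , j) as far as the boxes before it in reading order are concerned.
    record Compatible (b : Board) (i j : ℕ) (x : Letter n) : Set where
      constructor compatible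
      field
        left-≼ : ∀ {A} → left b i j ≡ just A → A ≼ ⁅ x ⁆
        above-≼ : ∀ {A} → above b i j ≡ just A → A ≼ ⁅ x ⁆
        new-in-column : Unprimed {n} x → ∀ {i′} → i′ < i → ∀ {A} → b i′ j ≡ just A → x ∉ A
        new-in-row : Primed {n} x → ∀ {j′} → j′ < j → ∀ {A} → b i j′ ≡ just A → x ∉ A
        allowed-at : Allowed i j x

    compatible? : ∀ b i j x → Dec (Compatible b i j x)
    compatible? b i j x = map′
      (λ (l , a , c , r , al) → compatible (λ {A} → l {A}) (λ {A} → a {A}) c r al)
      (λ (compatible l a c r al) → (λ {A} → l {A}) , (λ {A} → a {A}) , c , r , al)
      (∀-just? (left b i j) (_≼? ⁅ x ⁆) ×-dec ∀-just? (above b i j) (_≼? ⁅ x ⁆) ×-dec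
       (unprimed? x →-dec allUpTo? (λ i′ → ∀-just? (b i′ j) (λ A → ¬? (x ∈? A))) i) ×-dec
       (primed? x →-dec allUpTo? (λ j′ → ∀-just? (b i j′) (λ A → ¬? (x ∈? A))) j) ×-dec
       allowed? i j x)

    Greedy : Board → ℕ → ℕ → Set
    Greedy b i j = ∀ {A} → b i j ≡ just A → ∃[ x ] (Least (Compatible b i j) x × A ≡ ⁅ x ⁆)

    greedy? : ∀ b i j → Dec (Greedy b i j)
    greedy? b i j = ∀-just? (b i j) singleton-of-least?
      where
        singleton-of-least? : ∀ A → Dec (∃[ x ] (Least (Compatible b i j) x × A ≡ ⁅ x ⁆))
        singleton-of-least? A with least? (compatible? b i j)
        ... | inj₂ none = no λ (x , (cx , _) , _) → none x cx
        ... | inj₁ (x , least) = map′ (λ A≡⁅x⁆ → x , least , A≡⁅x⁆)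
          (λ (x′ , least′ , A≡⁅x′⁆) → trans A≡⁅x′⁆ (cong ⁅_⁆ (least-unique least′ least)))
          (Vec.≡-dec Bool._≟_ A ⁅ x ⁆)

    open IsTableau
    open Compatible

    left-≼-tableau : ∀ {b} → IsTableau b → ∀ {i j L A} → left b i j ≡ just L → b i j ≡ just A → L ≼ A
    left-≼-tableau T {j = suc j} eL eA = rows-weak T eL eA

    above-≼-tableau : ∀ {b} → IsTableau b → ∀ {i j U A} → above b i j ≡ just U → b i j ≡ just A → U ≼ A
    above-≼-tableau T {i = suc i} eU eA = columns-weak T eU eA

    ∈⇒compatible : ∀ {b} → IsTableau b → ∀ {i j A a} → b i j ≡ just A → a ∈ A → Compatible b i j a
    ∈⇒compatible T eA a∈A = compatible
      (λ eL → ≼-⁅⁆ (left-≼-tableau T eL eA) a∈A)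
      (λ eU → ≼-⁅⁆ (above-≼-tableau T eU eA) a∈A)
      (λ u i′<i eB a∈B → unprimed-once-per-column T eB i′<i eA u a∈B a∈A)
      (λ p j′<j eB a∈B → primed-once-per-row T eB j′<j eA p a∈B a∈A)
      (allowed T eA a∈A)

    AgreeBefore : Board → Board → ℕ → ℕ → Set
    AgreeBefore b b′ i j = ∀ {i′ j′} → (i′ , j′) ≺ (i , j) → b i′ j′ ≡ b′ i′ j′

    left-agree : ∀ {b b′ i j} → AgreeBefore b b′ i j → left b i j ≡ left b′ i j
    left-agree {j = zero}  agree = refl
    left-agree {j = suc j} agree = agree (inj₂ (refl , ≤-refl))

    above-agree : ∀ {b b′ i j} → AgreeBefore b b′ i j → above b i j ≡ above b′ i j
    above-agree {i = zero}  agree = refl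
    above-agree {i = suc i} agree = agree (inj₁ ≤-refl)

    compatible-cong : ∀ {b b′ i j x} → AgreeBefore b b′ i j → Compatible b i j x → Compatible b′ i j x
    compatible-cong agree (compatible l a c r al) = compatible
      (l ∘ trans (left-agree agree)) (a ∘ trans (above-agree agree))
      (λ u i′<i → c u i′<i ∘ trans (agree (inj₁ i′<i)))
      (λ p j′<j → r p j′<j ∘ trans (agree (inj₂ (refl , j′<j))))
      al

    least-compatible-cong : ∀ {b b′ i j x} → AgreeBefore b b′ i j →
      Least (Compatible b i j) x → Least (Compatible b′ i j) x
    least-compatible-cong agree (cx , below) =
      compatible-cong agree cx , λ y<x cy → below y<x (compatible-cong (sym ∘ agree) cy)

    greedy-cong : ∀ {b b′ i j} → AgreeBefore b b′ i j → b i j ≡ b′ i j → Greedy b i j → Greedy b′ i j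
    greedy-cong agree same greedy eA with greedy (trans same eA)
    ... | x , least , A≡⁅x⁆ = x , least-compatible-cong agree least , A≡⁅x⁆

    RowsWeak⁺ ColumnsWeak⁺ : Board → Set
    RowsWeak⁺    b = ∀ {i j j′ A B} → j < j′ → b i j ≡ just A → b i j′ ≡ just B → A ≼ B
    ColumnsWeak⁺ b = ∀ {i i′ j A B} → i < i′ → b i j ≡ just A → b i′ j ≡ just B → A ≼ B

    record FitsAt (b : Board) (i j : ℕ) (A′ : Subset (2 * n)) : Set where
      field
        fits-nonempty : Nonempty A′
        fits-left : ∀ {L} → left b i j ≡ just L → L ≼ A′
        fits-above : ∀ {U} → above b i j ≡ just U → U ≼ A′
        fits-right : ∀ {R} → b i (suc j) ≡ just R → A′ ≼ R
        fits-below : ∀ {D} → b (suc i) j ≡ just D → A′ ≼ D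
        fits-column : ∀ {i′ B t} → i′ ≢ i → b i′ j ≡ just B → Unprimed {n} t → t ∈ A′ → t ∉ B
        fits-row : ∀ {j′ B t} → j′ ≢ j → b i j′ ≡ just B → Primed {n} t → t ∈ A′ → t ∉ B
        fits-allowed : ∀ {t} → t ∈ A′ → Allowed i j t

    record ReplacedAt (b b′ : Board) (i j : ℕ) (A′ : Subset (2 * n)) : Set where
      field
        unchanged : ∀ {i′ j′} → (i′ , j′) ≢ (i , j) → b′ i′ j′ ≡ b i′ j′
        changed : b′ i j ≡ just A′

      from-old : ∀ {i′ j′ C} → (i′ , j′) ≢ (i , j) → b′ i′ j′ ≡ just C → b i′ j′ ≡ just C
      from-old ne e = trans (sym (unchanged ne)) e

      at-changed : ∀ {C} → b′ i j ≡ just C → C ≡ A′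
      at-changed e = just-injective (trans (sym e) changed)

    open FitsAt
    open ReplacedAt

    _≟ₚ_ : (p q : ℕ × ℕ) → Dec (p ≡ q)
    _≟ₚ_ = ×-≡-dec _≟_ _≟_

    replace-nonempty : ∀ {b b′ i j A′} → IsTableau b → ReplacedAt b b′ i j A′ → FitsAt b i j A′ →
      ∀ {i′ j′ C} → b′ i′ j′ ≡ just C → Nonempty C
    replace-nonempty {i = i} {j} T R F {i′} {j′} e with (i′ , j′) ≟ₚ (i , j)
    ... | yes refl = subst Nonempty (sym (at-changed R e)) (fits-nonempty F)
    ... | no  ne   = nonempty T (from-old R ne e)

    replace-rows-weak : ∀ {b b′ i j A′} → IsTableau b → ReplacedAt b b′ i j A′ → FitsAt b i j A′ →
      ∀ {i′ j′ C} → b′ i′ j′ ≡ just C → ∀ {D} → b′ i′ (suc j′) ≡ just D → C ≼ D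
    replace-rows-weak {i = i} {j} T R F {i′} {j′} eC eD
      with (i′ , j′) ≟ₚ (i , j) | (i′ , suc j′) ≟ₚ (i , j)
    ... | yes refl | _        =
          subst (_≼ _) (sym (at-changed R eC)) (fits-right F (from-old R (1+n≢n ∘ cong proj₂) eD))
    ... | no  ne   | yes refl = subst (_ ≼_) (sym (at-changed R eD)) (fits-left F (from-old R ne eC))
    ... | no  ne   | no  ne′  = rows-weak T (from-old R ne eC) (from-old R ne′ eD)

    replace-columns-weak : ∀ {b b′ i j A′} → IsTableau b → ReplacedAt b b′ i j A′ → FitsAt b i j A′ →
      ∀ {i′ j′ C} → b′ i′ j′ ≡ just C → ∀ {D} → b′ (suc i′) j′ ≡ just D → C ≼ D
    replace-columns-weak {i = i} {j} T R F {i′} {j′} eC eD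
      with (i′ , j′) ≟ₚ (i , j) | (suc i′ , j′) ≟ₚ (i , j)
    ... | yes refl | _        =
          subst (_≼ _) (sym (at-changed R eC)) (fits-below F (from-old R (1+n≢n ∘ cong proj₁) eD))
    ... | no  ne   | yes refl = subst (_ ≼_) (sym (at-changed R eD)) (fits-above F (from-old R ne eC))
    ... | no  ne   | no  ne′  = columns-weak T (from-old R ne eC) (from-old R ne′ eD)

    replace-unprimed-once-per-column : ∀ {b b′ i j A′} →
      IsTableau b → ReplacedAt b b′ i j A′ → FitsAt b i j A′ →
      ∀ {i₁ j′ C} → b′ i₁ j′ ≡ just C → ∀ {i₂} → i₁ < i₂ → ∀ {D} → b′ i₂ j′ ≡ just D →
      ∀ {t} → Unprimed {n} t → t ∈ C → t ∉ D
    replace-unprimed-once-per-column {i = i} {j} T R F {i₁} {j′} eC {i₂} i₁<i₂ eD u t∈C t∈D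
      with (i₁ , j′) ≟ₚ (i , j) | (i₂ , j′) ≟ₚ (i , j)
    ... | yes refl | _        = fits-column F (>⇒≢ i₁<i₂) (from-old R (>⇒≢ i₁<i₂ ∘ cong proj₁) eD) u
                                  (subst (_ ∈_) (at-changed R eC) t∈C) t∈D
    ... | no  ne   | yes refl =
          fits-column F (<⇒≢ i₁<i₂) (from-old R ne eC) u (subst (_ ∈_) (at-changed R eD) t∈D) t∈C
    ... | no  ne   | no  ne′  =
          unprimed-once-per-column T (from-old R ne eC) i₁<i₂ (from-old R ne′ eD) u t∈C t∈D

    replace-primed-once-per-row : ∀ {b b′ i j A′} →
      IsTableau b → ReplacedAt b b′ i j A′ → FitsAt b i j A′ →
      ∀ {i′ j₁ C} → b′ i′ j₁ ≡ just C → ∀ {j₂} → j₁ < j₂ → ∀ {D} → b′ i′ j₂ ≡ just D →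
      ∀ {t} → Primed {n} t → t ∈ C → t ∉ D
    replace-primed-once-per-row {i = i} {j} T R F {i′} {j₁} eC {j₂} j₁<j₂ eD p t∈C t∈D
      with (i′ , j₁) ≟ₚ (i , j) | (i′ , j₂) ≟ₚ (i , j)
    ... | yes refl | _        = fits-row F (>⇒≢ j₁<j₂) (from-old R (>⇒≢ j₁<j₂ ∘ cong proj₂) eD) p
                                  (subst (_ ∈_) (at-changed R eC) t∈C) t∈D
    ... | no  ne   | yes refl =
          fits-row F (<⇒≢ j₁<j₂) (from-old R ne eC) p (subst (_ ∈_) (at-changed R eD) t∈D) t∈C
    ... | no  ne   | no  ne′  = primed-once-per-row T (from-old R ne eC) j₁<j₂ (from-old R ne′ eD) p t∈C t∈D

    replace-allowed : ∀ {b b′ i j A′} → IsTableau b → ReplacedAt b b′ i j A′ → FitsAt b i j A′ →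
      ∀ {i′ j′ C} → b′ i′ j′ ≡ just C → ∀ {t} → t ∈ C → Allowed i′ j′ t
    replace-allowed {i = i} {j} T R F {i′} {j′} e t∈C with (i′ , j′) ≟ₚ (i , j)
    ... | yes refl = fits-allowed F (subst (_ ∈_) (at-changed R e) t∈C)
    ... | no  ne   = allowed T (from-old R ne e) t∈C

    replace-IsTableau : ∀ {b b′ i j A′} → IsTableau b → ReplacedAt b b′ i j A′ → FitsAt b i j A′ →
      IsTableau b′
    replace-IsTableau T R F = record
      { nonempty                 = replace-nonempty T R F
      ; rows-weak                = replace-rows-weak T R F
      ; columns-weak             = replace-columns-weak T R F
      ; unprimed-once-per-column = replace-unprimed-once-per-column T R F
      ; primed-once-per-row      = replace-primed-once-per-row T R F
      ; allowed                  = replace-allowed T R F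
      }

    least-compatible-≤ : ∀ {b} → IsTableau b → ∀ {i j A x a} → b i j ≡ just A →
      Least (Compatible b i j) x → a ∈ A → x Fin.≤ a
    least-compatible-≤ T eA (_ , x-least) a∈A = ≮⇒≥ λ a<x → x-least a<x (∈⇒compatible T eA a∈A)

    module LeastExtension {b i j A x A′} (T : IsTableau b) (rows⁺ : RowsWeak⁺ b) (columns⁺ : ColumnsWeak⁺ b)
      (eA : b i j ≡ just A) (least : Least (Compatible b i j) x) (A′⊆ : A′ ⊆ A ∪ ⁅ x ⁆) where

      private
        cx : Compatible b i j x
        cx = proj₁ least
        a₀ : Letter n
        a₀ = proj₁ (nonempty T eA)
        a₀∈A : a₀ ∈ A
        a₀∈A = proj₂ (nonempty T eA)

      new-or-old : ∀ {t} → t ∈ A′ → t ≡ x ⊎ t ∈ A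
      new-or-old t∈A′ = [ inj₂ , inj₁ ∘ x∈⁅y⁆⇒x≡y x ]′ (x∈p∪q⁻ A ⁅ x ⁆ (A′⊆ t∈A′))

      x≤-after : ∀ {B c} → A ≼ B → c ∈ B → x Fin.≤ c
      x≤-after A≼B c∈B = Fin.≤-trans (least-compatible-≤ T eA least a₀∈A) (A≼B a₀ _ a₀∈A c∈B)

      x∈-after⇒x∈A : ∀ {B} → A ≼ B → x ∈ B → x ∈ A
      x∈-after⇒x∈A A≼B x∈B =
        subst (_∈ A) (Fin.≤-antisym (A≼B a₀ x a₀∈A x∈B) (least-compatible-≤ T eA least a₀∈A)) a₀∈A

      fits-before : ∀ {B} → B ≼ A → B ≼ ⁅ x ⁆ → B ≼ A′
      fits-before B≼A B≼x c t c∈B t∈A′ =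
        [ (λ { refl → B≼x c x c∈B (x∈⁅x⁆ x) }) , B≼A c t c∈B ]′ (new-or-old t∈A′)

      fits-after : ∀ {B} → A ≼ B → A′ ≼ B
      fits-after A≼B t c t∈A′ c∈B =
        [ (λ { refl → x≤-after A≼B c∈B }) , (λ t∈A → A≼B t c t∈A c∈B) ]′ (new-or-old t∈A′)

      fits-in-column : ∀ {i′ B t} → i′ ≢ i → b i′ j ≡ just B → Unprimed {n} t → t ∈ A′ → t ∉ B
      fits-in-column {i′} i′≢i eB u t∈A′ t∈B with new-or-old t∈A′ | <-cmp i′ i
      ... | _         | tri≈ _ i′≡i _ = i′≢i i′≡i
      ... | inj₂ t∈A  | tri< i′<i _ _ = unprimed-once-per-column T eB i′<i eA u t∈B t∈A
      ... | inj₂ t∈A  | tri> _ _ i<i′ = unprimed-once-per-column T eA i<i′ eB u t∈A t∈B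
      ... | inj₁ refl | tri< i′<i _ _ = new-in-column cx u i′<i eB t∈B
      ... | inj₁ refl | tri> _ _ i<i′ =
            unprimed-once-per-column T eA i<i′ eB u (x∈-after⇒x∈A (columns⁺ i<i′ eA eB) t∈B) t∈B

      fits-in-row : ∀ {j′ B t} → j′ ≢ j → b i j′ ≡ just B → Primed {n} t → t ∈ A′ → t ∉ B
      fits-in-row {j′} j′≢j eB p t∈A′ t∈B with new-or-old t∈A′ | <-cmp j′ j
      ... | _         | tri≈ _ j′≡j _ = j′≢j j′≡j
      ... | inj₂ t∈A  | tri< j′<j _ _ = primed-once-per-row T eB j′<j eA p t∈B t∈A
      ... | inj₂ t∈A  | tri> _ _ j<j′ = primed-once-per-row T eA j<j′ eB p t∈A t∈B
      ... | inj₁ refl | tri< j′<j _ _ = new-in-row cx p j′<j eB t∈B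
      ... | inj₁ refl | tri> _ _ j<j′ =
            primed-once-per-row T eA j<j′ eB p (x∈-after⇒x∈A (rows⁺ j<j′ eA eB) t∈B) t∈B

      fits : Nonempty A′ → FitsAt b i j A′
      fits A′≠∅ = record
        { fits-nonempty = A′≠∅
        ; fits-left     = λ eL → fits-before (left-≼-tableau T eL eA) (left-≼ cx eL)
        ; fits-above    = λ eU → fits-before (above-≼-tableau T eU eA) (above-≼ cx eU)
        ; fits-right    = λ eR → fits-after (rows-weak T eA eR)
        ; fits-below    = λ eD → fits-after (columns-weak T eA eD)
        ; fits-column   = fits-in-column
        ; fits-row      = fits-in-row
        ; fits-allowed  = λ t∈A′ → [ (λ { refl → allowed-at cx }) , allowed T eA ]′ (new-or-old t∈A′)
        }

    not-greedy : ∀ {b i j A x} → b i j ≡ just A → Least (Compatible b i j) x → A ≢ ⁅ x ⁆ → ¬ Greedy b i j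
    not-greedy eA least A≢⁅x⁆ greedy with greedy eA
    ... | x′ , least′ , A≡⁅x′⁆ = A≢⁅x⁆ (trans A≡⁅x′⁆ (cong ⁅_⁆ (least-unique least′ least)))

    least-compatible : ∀ {b} → IsTableau b → ∀ {i j A} → b i j ≡ just A → ∃ (Least (Compatible b i j))
    least-compatible {b} T {i} {j} eA with least? (compatible? b i j)
    ... | inj₁ found = found
    ... | inj₂ none  = contradiction (∈⇒compatible T eA (proj₂ (nonempty T eA))) (none _)

    ¬greedy⇒toggleable : ∀ {b} → IsTableau b → ∀ {i j} → ¬ Greedy b i j →
      ∃[ A ] ∃[ x ] (b i j ≡ just A × Least (Compatible b i j) x × A ≢ ⁅ x ⁆)
    ¬greedy⇒toggleable {b} T {i} {j} ¬greedy with b i j in eA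
    ... | nothing = contradiction (λ ()) ¬greedy
    ... | just A with least-compatible T eA
    ...   | x , least = A , x , refl , least , λ A≡⁅x⁆ → ¬greedy λ { refl → x , least , A≡⁅x⁆ }

    module _ {b : Board} {H W : ℕ} (support : ∀ {i j A} → b i j ≡ just A → i < H × j < W) where

      private
        absent-row : ∀ {i j A} → H ≤ i → b i j ≡ just A → ⊥
        absent-row H≤i eA = <⇒≱ (proj₁ (support eA)) H≤i

        absent-column : ∀ {i j A} → W ≤ j → b i j ≡ just A → ⊥
        absent-column W≤j eA = <⇒≱ (proj₂ (support eA)) W≤j

        ∀box? : ∀ {Q : ℕ → ℕ → Subset (2 * n) → Set} → (∀ i j A → Dec (Q i j A)) →
          Dec (∀ {i j A} → b i j ≡ just A → Q i j A)
        ∀box? Q? = ∀ℕ? H (λ i → ∀ℕ? W (λ j → ∀-just? (b i j) (Q? i j))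
                           (λ W≤j eA → ⊥-elim (absent-column W≤j eA)))
                       (λ H≤i eA → ⊥-elim (absent-row H≤i eA))

      isTableau? : Dec (IsTableau b)
      isTableau?
        with ∀box? (λ _ _ → nonempty?)
           | ∀box? (λ i j A → ∀-just? (b i (suc j)) (A ≼?_))
           | ∀box? (λ i j A → ∀-just? (b (suc i) j) (A ≼?_))
           | ∀box? (λ i j A → ∀ℕ? H (λ i′ → (i <? i′) →-dec ∀-just? (b i′ j) λ B →
                 ∀Fin? λ t → unprimed? t →-dec (t ∈? A) →-dec ¬? (t ∈? B))
               (λ H≤i′ _ eB → ⊥-elim (absent-row H≤i′ eB)))
           | ∀box? (λ i j A → ∀ℕ? W (λ j′ → (j <? j′) →-dec ∀-just? (b i j′) λ B →
                 ∀Fin? λ t → primed? t →-dec (t ∈? A) →-dec ¬? (t ∈? B))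
               (λ W≤j′ _ eB → ⊥-elim (absent-column W≤j′ eB)))
           | ∀box? (λ i j A → ∀Fin? λ t → (t ∈? A) →-dec allowed? i j t)
      ... | yes ne | yes rw | yes cw | yes uc | yes pr | yes al = yes record
        { nonempty = ne ; rows-weak = rw ; columns-weak = cw
        ; unprimed-once-per-column = uc ; primed-once-per-row = pr ; allowed = al }
      ... | no ¬ne | _      | _      | _      | _      | _      = no λ T → ¬ne (nonempty T)
      ... | _      | no ¬rw | _      | _      | _      | _      = no λ T → ¬rw (rows-weak T)
      ... | _      | _      | no ¬cw | _      | _      | _      = no λ T → ¬cw (columns-weak T)
      ... | _      | _      | _      | no ¬uc | _      | _      = no λ T → ¬uc (unprimed-once-per-column T)
      ... | _      | _      | _      | _      | no ¬pr | _      = no λ T → ¬pr (primed-once-per-row T)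
      ... | _      | _      | _      | _      | _      | no ¬al = no λ T → ¬al (allowed T)

    module SkewShape (la mu : Partition) (la-strict : Strict la) (mu-strict : Strict mu) where

      ⟦_⟧ : Filling n → Board
      ⟦ F ⟧ = board mu F

      Valid : Filling n → Set
      Valid F = HasShape {n} la mu F × IsTableau ⟦ F ⟧

      IsBox-of : ∀ {F i j A} → HasShape {n} la mu F → ⟦ F ⟧ i j ≡ just A → IsBox la mu i j
      IsBox-of {F} shape = board-just⇒IsBox la mu F shape

      height width : ℕ
      height = suc (length la)
      width  = offset la 0

      bounded : ∀ {F i j A} → HasShape {n} la mu F → ⟦ F ⟧ i j ≡ just A → i < height × j < width
      bounded {i = i} shape eA with i | IsBox-of shape eA
      ... | suc r | r<ℓ , _ , j< = s≤s r<ℓ , <-≤-trans j< (offset-antitone (proj₁ la-strict) z≤n r<ℓ)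

      greedy-outside : ∀ {F i j} → HasShape {n} la mu F → ¬ (i < height × j < width) → Greedy ⟦ F ⟧ i j
      greedy-outside shape outside eA = contradiction (bounded shape eA) outside

      rows-weak⁺ : ∀ {F} → Valid F → RowsWeak⁺ ⟦ F ⟧
      rows-weak⁺ {F} v@(shape , T) {i} {j} {suc j′} j<1+j′ eA eB with m≤n⇒m<n∨m≡n (≤-pred j<1+j′)
      ... | inj₂ refl = rows-weak T eA eB
      ... | inj₁ j<j′ = ≼-trans (nonempty T eM) (rows-weak⁺ v j<j′ eA eM) (rows-weak T eM eB)
        where
          middle : ∃[ M ] ⟦ F ⟧ i j′ ≡ just M
          middle = IsBox⇒board-just la mu F shape
            (IsBox-row-between (IsBox-of shape eA) (IsBox-of shape eB) (<⇒≤ j<j′) (n≤1+n j′))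
          eM : ⟦ F ⟧ i j′ ≡ just (proj₁ middle)
          eM = proj₂ middle

      columns-weak⁺ : ∀ {F} → Valid F → ColumnsWeak⁺ ⟦ F ⟧
      columns-weak⁺ {F} v@(shape , T) {i} {suc i′} {j} i<1+i′ eA eB with m≤n⇒m<n∨m≡n (≤-pred i<1+i′)
      ... | inj₂ refl = columns-weak T eA eB
      ... | inj₁ i<i′ = ≼-trans (nonempty T eM) (columns-weak⁺ v i<i′ eA eM) (columns-weak T eM eB)
        where
          middle : ∃[ M ] ⟦ F ⟧ i′ j ≡ just M
          middle = IsBox⇒board-just la mu F shape
            (IsBox-column-between la-strict mu-strict (IsBox-of shape eA) (IsBox-of shape eB)
              (<⇒≤ i<i′) (n≤1+n i′))
          eM : ⟦ F ⟧ i′ j ≡ just (proj₁ middle)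
          eM = proj₂ middle

      updateBox-ReplacedAt : ∀ {F i j A} f → ⟦ F ⟧ i j ≡ just A →
        ReplacedAt ⟦ F ⟧ ⟦ updateBox mu F i j f ⟧ i j (f A)
      updateBox-ReplacedAt {F} f eA = record
        { unchanged = board-updateBox-other mu F f eA
        ; changed   = board-updateBox-same mu F f eA
        }

      updateBox-valid : ∀ {F i j A x} f → Valid F → ⟦ F ⟧ i j ≡ just A → Least (Compatible ⟦ F ⟧ i j) x →
        Nonempty (f A) → f A ⊆ A ∪ ⁅ x ⁆ → Valid (updateBox mu F i j f)
      updateBox-valid {F} {i} {j} f v@(shape , T) eA least fA≠∅ fA⊆ =
        updateBox-HasShape la mu F i j f shape ,
        replace-IsTableau T (updateBox-ReplacedAt f eA)
          (LeastExtension.fits T (rows-weak⁺ v) (columns-weak⁺ v) eA least fA⊆ fA≠∅)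

      updateBox-agree : ∀ {F i j A i′ j′} f → ⟦ F ⟧ i j ≡ just A → ¬ (i , j) ≺ (i′ , j′) →
        AgreeBefore ⟦ F ⟧ ⟦ updateBox mu F i j f ⟧ i′ j′
      updateBox-agree {F} f eA not-after p≺ = sym (board-updateBox-other mu F f eA λ { refl → not-after p≺ })

      GreedyBefore : Filling n → ℕ → ℕ → Set
      GreedyBefore F i j = ∀ {i′ j′} → (i′ , j′) ≺ (i , j) → Greedy ⟦ F ⟧ i′ j′

      AllGreedy : Filling n → Set
      AllGreedy F = ∀ i j → Greedy ⟦ F ⟧ i j

      greedy-if-not-refuted : ∀ {F i j} → HasShape {n} la mu F →
        (i < height → j < width → ¬ ¬ Greedy ⟦ F ⟧ i j) → Greedy ⟦ F ⟧ i j
      greedy-if-not-refuted {F} {i} {j} shape ¬¬greedy with i <? height | j <? width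
      ... | yes i<h | yes j<w = decidable-stable (greedy? ⟦ F ⟧ i j) (¬¬greedy i<h j<w)
      ... | no  i≮h | _       = greedy-outside shape (i≮h ∘ proj₁)
      ... | yes _   | no  j≮w = greedy-outside shape (j≮w ∘ proj₂)

      data σ-Spec (F : Filling n) : Filling n → Set where
        all-greedy : AllGreedy F → σ-Spec F F
        toggled : ∀ {i j A x} → GreedyBefore F i j → ⟦ F ⟧ i j ≡ just A → Least (Compatible ⟦ F ⟧ i j) x →
          A ≢ ⁅ x ⁆ → σ-Spec F (updateBox mu F i j (toggle x))

      opaque
        toggleAt : Filling n → ℕ → ℕ → Filling n
        toggleAt F i j with least? (compatible? ⟦ F ⟧ i j)
        ... | inj₁ (x , _) = updateBox mu F i j (toggle x)
        ... | inj₂ _       = F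

        toggleAt-least : ∀ {F i j x} → Least (Compatible ⟦ F ⟧ i j) x →
          toggleAt F i j ≡ updateBox mu F i j (toggle x)
        toggleAt-least {F} {i} {j} least with least? (compatible? ⟦ F ⟧ i j)
        ... | inj₁ (x′ , least′) = cong (λ y → updateBox mu F i j (toggle y)) (least-unique least′ least)
        ... | inj₂ none          = contradiction (proj₁ least) (none _)

        σ : Filling n → Filling n
        σ F with lexLeastBelow? height width (λ i j → ¬? (greedy? ⟦ F ⟧ i j))
        ... | inj₁ ((i , j) , _) = toggleAt F i j
        ... | inj₂ _             = F

        σ-spec : ∀ {F} → Valid F → σ-Spec F (σ F)
        σ-spec {F} (shape , T) with lexLeastBelow? height width (λ i j → ¬? (greedy? ⟦ F ⟧ i j))
        ... | inj₂ none = all-greedy λ i j → greedy-if-not-refuted shape none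
        ... | inj₁ ((i , j) , _ , _ , ¬greedy , earlier) with ¬greedy⇒toggleable T ¬greedy
        ...   | A , x , eA , least , A≢⁅x⁆ = subst (σ-Spec F) (sym (toggleAt-least least))
                (toggled (λ p≺ → greedy-if-not-refuted shape (earlier p≺)) eA least A≢⁅x⁆)

      σ-valid : ∀ {F} → Valid F → Valid (σ F)
      σ-valid {F} v with σ F | σ-spec v
      ... | _ | all-greedy _ = v
      ... | _ | toggled _ eA least A≢⁅x⁆ = updateBox-valid _ v eA least (toggle-nonempty A≢⁅x⁆) toggle-⊆

      all-greedy⇒σ-fixed : ∀ {F} → Valid F → AllGreedy F → σ F ≡ F
      all-greedy⇒σ-fixed {F} v greedy with σ F | σ-spec v
      ... | _ | all-greedy _ = refl
      ... | _ | toggled {i} {j} _ eA least A≢⁅x⁆ = ⊥-elim (not-greedy eA least A≢⁅x⁆ (greedy i j))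

      σ-fixed⇒all-greedy : ∀ {F} → Valid F → σ F ≡ F → AllGreedy F
      σ-fixed⇒all-greedy {F} v σF≡F with σ F | σ-spec v
      ... | _ | all-greedy greedy = greedy
      ... | _ | toggled {i} {j} _ eA _ _ = contradiction
        (just-injective (trans (sym (board-updateBox-same mu F _ eA)) (trans (cong (λ G → ⟦ G ⟧ i j) σF≡F) eA)))
        toggle-≢

      σ-undoes-toggle : ∀ {F i j A x} → Valid F → GreedyBefore F i j → ⟦ F ⟧ i j ≡ just A →
        Least (Compatible ⟦ F ⟧ i j) x → A ≢ ⁅ x ⁆ → σ (updateBox mu F i j (toggle x)) ≡ F
      σ-undoes-toggle {F} {i} {j} {A} {x} v@(_ , T) before eA least A≢⁅x⁆ = undo (σ-spec v′)
        where
          F′ : Filling n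
          F′ = updateBox mu F i j (toggle x)
          v′ : Valid F′
          v′ = updateBox-valid (toggle x) v eA least (toggle-nonempty A≢⁅x⁆) toggle-⊆
          least′ : Least (Compatible ⟦ F′ ⟧ i j) x
          least′ = least-compatible-cong (updateBox-agree (toggle x) eA ≺-irrefl) least
          ¬greedy′ : ¬ Greedy ⟦ F′ ⟧ i j
          ¬greedy′ = not-greedy (board-updateBox-same mu F (toggle x) eA) least′ (toggle-≢-⁅⁆ (nonempty T eA))
          undo : ∀ {G} → σ-Spec F′ G → G ≡ F
          undo (all-greedy greedy′) = ⊥-elim (¬greedy′ (greedy′ i j))
          undo (toggled {i′} {j′} before′ eA′ least″ A′≢) with Lex.compare (i′ , j′) (i , j)
          ... | tri< p≺ _ _ = ⊥-elim (not-greedy eA′ least″ A′≢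
                  (greedy-cong (updateBox-agree (toggle x) eA (Lex.asym p≺))
                    (sym (board-updateBox-other mu F (toggle x) eA (≺⇒≢ p≺))) (before p≺)))
          ... | tri> _ _ p≻ = ⊥-elim (¬greedy′ (before′ p≻))
          ... | tri≈ _ (refl , refl) _ =
            trans (cong (λ y → updateBox mu F′ i j (toggle y)) (least-unique least″ least′))
                  (updateBox-involutive mu F i j (λ _ → toggle-involutive))

      σ-involutive : ∀ {F} → Valid F → σ (σ F) ≡ F
      σ-involutive {F} v with σ F | σ-spec v
      ... | _ | all-greedy greedy = all-greedy⇒σ-fixed v greedy
      ... | _ | toggled before eA least A≢⁅x⁆ = σ-undoes-toggle v before eA least A≢⁅x⁆

      all-greedy-unique : ∀ {F G} → Valid F → Valid G → AllGreedy F → AllGreedy G → F ≡ G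
      all-greedy-unique {F} {G} (shapeF , _) (shapeG , _) greedyF greedyG =
        board-ext la mu F G shapeF shapeG λ i j → same-box (i , j)
        where
          SameBox : ℕ × ℕ → Set
          SameBox (i , j) = ⟦ F ⟧ i j ≡ ⟦ G ⟧ i j
          step : ∀ p → (∀ {q} → q ≺ p → SameBox q) → SameBox p
          step (i , j) earlier with ⟦ F ⟧ i j in eF | ⟦ G ⟧ i j in eG
          ... | nothing | nothing = refl
          ... | just A  | nothing
                with () ← trans (sym eG) (proj₂ (IsBox⇒board-just la mu G shapeG (IsBox-of shapeF eF)))
          ... | nothing | just B
                with () ← trans (sym eF) (proj₂ (IsBox⇒board-just la mu F shapeF (IsBox-of shapeG eG)))
          ... | just A  | just B  with greedyF i j eF | greedyG i j eG
          ...   | x , least-x , A≡⁅x⁆ | y , least-y , B≡⁅y⁆ = cong just (begin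
            A     ≡⟨ A≡⁅x⁆ ⟩
            ⁅ x ⁆ ≡⟨ cong ⁅_⁆ (least-unique (least-compatible-cong earlier least-x) least-y) ⟩
            ⁅ y ⁆ ≡⟨ B≡⁅y⁆ ⟨
            B     ∎)
            where open ≡-Reasoning
          same-box : ∀ p → SameBox p
          same-box = WF.All.wfRec ≺-wellFounded 0ℓ SameBox step

      greedy-step : ∀ {F i j} → Valid F → GreedyBefore F i j → ∃[ G ] (Valid G × GreedyBefore G i (suc j))
      greedy-step {F} {i} {j} v@(_ , T) before with greedy? ⟦ F ⟧ i j
      ... | yes greedy = F , v , λ p≺ → [ before , (λ { refl → greedy }) ]′ (≺-suc⁻ p≺)
      ... | no ¬greedy with ¬greedy⇒toggleable T ¬greedy
      ...   | A , x , eA , least , _ =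
              G , updateBox-valid (const ⁅ x ⁆) v eA least (x , x∈⁅x⁆ x) (q⊆p∪q A ⁅ x ⁆) , before′
        where
          G : Filling n
          G = updateBox mu F i j (const ⁅ x ⁆)
          before′ : GreedyBefore G i (suc j)
          before′ p≺ with ≺-suc⁻ p≺
          ... | inj₁ q≺ = greedy-cong (updateBox-agree _ eA (Lex.asym q≺))
                            (sym (board-updateBox-other mu F _ eA (≺⇒≢ q≺))) (before q≺)
          ... | inj₂ refl = λ eA′ →
                x , least-compatible-cong (updateBox-agree _ eA ≺-irrefl) least ,
                just-injective (trans (sym eA′) (board-updateBox-same mu F _ eA))

      next-row : ∀ {F i} → HasShape {n} la mu F → GreedyBefore F i width → GreedyBefore F (suc i) 0
      next-row {F} {i} shape before {i′} {j′} (inj₁ i′<1+i)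
        with m≤n⇒m<n∨m≡n (≤-pred i′<1+i) | j′ <? width
      ... | inj₁ i′<i | _        = before (inj₁ i′<i)
      ... | inj₂ refl | yes j′<w = before (inj₂ (refl , j′<w))
      ... | inj₂ refl | no  j′≮w = greedy-outside shape (j′≮w ∘ proj₂)

      greedy-prefix : ∀ {F} → Valid F → ∀ i j → ∃[ G ] (Valid G × GreedyBefore G i j)
      greedy-prefix v zero    zero    = _ , v , λ { (inj₁ ()) ; (inj₂ (_ , ())) }
      greedy-prefix v i       (suc j) with greedy-prefix v i j
      ... | G , vG , before = greedy-step vG before
      greedy-prefix v (suc i) zero    with greedy-prefix v i width
      ... | G , vG , before = G , vG , next-row (proj₁ vG) before

      all-greedy-exists : ∀ {F} → Valid F → ∃[ G ] (Valid G × AllGreedy G)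
      all-greedy-exists v with greedy-prefix v height 0
      ... | G , vG , before =
            G , vG , λ i j → greedy-if-not-refuted (proj₁ vG) λ i<h _ ¬greedy → ¬greedy (before (inj₁ i<h))

      valid? : ∀ F → Dec (Valid F)
      valid? F with List.≡-dec _≟_ (map length F) (rowLengths la mu)
      ... | no  lengths≢ = no λ (shape , _) → lengths≢ (HasShape⇒rowLengths la mu F shape)
      ... | yes lengths≡ = map′ (shape ,_) proj₂ (isTableau? (bounded shape))
        where
          shape : HasShape {n} la mu F
          shape = rowLengths⇒HasShape la mu F lengths≡

      rowsOfLength : ℕ → List (List (Subset (2 * n)))
      rowsOfLength k = products (replicate k (subsets (2 * n)))

      candidates : List (Filling n)
      candidates = products (map rowsOfLength (rowLengths la mu))

      candidates-unique : Unique candidates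
      candidates-unique = products-unique
        (map⁺ (universal (λ k → products-unique (replicate⁺ k (subsets-unique _))) (rowLengths la mu)))

      ∈-candidates : ∀ {F} → HasShape {n} la mu F → F ∈ₗ candidates
      ∈-candidates {F} shape = subst (λ ks → F ∈ₗ products (map rowsOfLength ks))
        (HasShape⇒rowLengths la mu F shape) (∈-products (rows-∈ F))
        where
          rows-∈ : ∀ F → Pointwise _∈ₗ_ F (map rowsOfLength (map length F))
          rows-∈ []        = []
          rows-∈ (row ∷ F) = ∈-products (∈-replicate ∈-subsets row) ∷ rows-∈ F

      valid-fillings : List (Filling n)
      valid-fillings = filter valid? candidates

      valid-count : HasCard Valid (length valid-fillings)
      valid-count = valid-fillings , Unique.filter⁺ valid? candidates-unique ,
        (λ F → mk⇔ (proj₂ ∘ ∈-filter⁻ valid? {xs = candidates})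
                   (λ v → ∈-filter⁺ valid? (∈-candidates (proj₁ v)) v)) ,
        refl

      _≟-filling_ : DecidableEquality (Filling n)
      _≟-filling_ = List.≡-dec (List.≡-dec (Vec.≡-dec Bool._≟_))

      odd-count : ∀ {F} → Valid F → Odd (length valid-fillings)
      odd-count v with all-greedy-exists v
      ... | G , vG , greedy =
            involution-with-unique-fixpoint⇒odd _≟-filling_ σ valid-count σ-valid σ-involutive
              vG (all-greedy⇒σ-fixed vG greedy)
              (λ vF σF≡F → all-greedy-unique vF vG (σ-fixed⇒all-greedy vF σF≡F) greedy)

    module _ (la mu : Partition) where

      IsSSVT-Q⇒IsTableau : ∀ {F} → IsSSVT-Q n la mu F →
        (∀ {i j A} → box {n} mu F i j ≡ just A → ∀ {t} → t ∈ A → Allowed i j t) → IsTableau (board mu F)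
      IsSSVT-Q⇒IsTableau {F} (_ , ne , rw , cw , uc , pr) al =
        subst (λ bx → IsTableau (bx mu F)) (sym board≡box) record
        { nonempty                 = λ {i} {j} {A} → ne i j A
        ; rows-weak                = λ {i} {j} {A} eA {B} → rw i j A B eA
        ; columns-weak             = λ {i} {j} {A} eA {B} → cw i j A B eA
        ; unprimed-once-per-column = λ {i} {j} {A} eA {i′} i<i′ {B} eB {t} → uc i i′ j A B t i<i′ eA eB
        ; primed-once-per-row      = λ {i} {j} {A} eA {j′} j<j′ {B} eB {t} → pr i j j′ A B t j<j′ eA eB
        ; allowed                  = al
        }

      board→box : ∀ {F} → IsTableau (board mu F) → IsTableau (box {n} mu F)
      board→box {F} = subst (λ bx → IsTableau (bx mu F)) board≡box

      IsTableau⇒IsSSVT-Q : ∀ {F} → HasShape {n} la mu F → IsTableau (board mu F) → IsSSVT-Q n la mu F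
      IsTableau⇒IsSSVT-Q {F} shape T′ =
        shape ,
        (λ i j A → nonempty T {i} {j} {A}) ,
        (λ i j A B eA → rows-weak T {i} {j} {A} eA {B}) ,
        (λ i j A B eA → columns-weak T {i} {j} {A} eA {B}) ,
        (λ i i′ j A B t i<i′ eA eB → unprimed-once-per-column T {i} {j} {A} eA {i′} i<i′ {B} eB {t}) ,
        (λ i j j′ A B t j<j′ eA eB → primed-once-per-row T {i} {j} {A} eA {j′} j<j′ {B} eB {t})
        where
          T : IsTableau (box {n} mu F)
          T = board→box T′

  UnprimedOnDiagonal : ℕ → ℕ → Letter n → Set
  UnprimedOnDiagonal i j t = i ≡ j → Unprimed {n} t

  unprimedOnDiagonal? : ∀ i j t → Dec (UnprimedOnDiagonal i j t)
  unprimedOnDiagonal? i j t = (i ≟ j) →-dec unprimed? t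

  module PTableaux = Tableaux UnprimedOnDiagonal unprimedOnDiagonal?
  module QTableaux = Tableaux (λ _ _ _ → ⊤) (λ _ _ _ → yes tt)

  module SSVT (la mu : Partition) (la-strict : Strict la) (mu-strict : Strict mu) where
    module P = PTableaux.SkewShape la mu la-strict mu-strict
    module Q = QTableaux.SkewShape la mu la-strict mu-strict

    P-valid⇔ : ∀ F → P.Valid F ⇔ IsSSVT-P n la mu F
    P-valid⇔ F = mk⇔
      (λ (shape , T) → PTableaux.IsTableau⇒IsSSVT-Q la mu shape T ,
        λ i A t eA t∈A → PTableaux.IsTableau.allowed (PTableaux.board→box la mu T) {i} {i} {A} eA t∈A refl)
      (λ (ssvt@(shape , _) , diagonal) → shape ,
        PTableaux.IsSSVT-Q⇒IsTableau la mu ssvt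
          λ {i} {j} {A} eA {t} t∈A → λ { refl → diagonal i A t eA t∈A })

    Q-valid⇔ : ∀ F → Q.Valid F ⇔ IsSSVT-Q n la mu F
    Q-valid⇔ F = mk⇔
      (λ (shape , T) → QTableaux.IsTableau⇒IsSSVT-Q la mu shape T)
      (λ ssvt@(shape , _) → shape , QTableaux.IsSSVT-Q⇒IsTableau la mu ssvt λ _ _ → tt)

corollary4p4 : (la mu : Partition) (n : ℕ) →
    Strict la → Strict mu → la ⊇ mu → 1 ≤ n →
    (∃[ F ] IsSSVT-P n la mu F) → (∃[ F ] IsSSVT-Q n la mu F) →
    (∃[ k ] (HasCard (IsSSVT-P n la mu) k × Odd k)) ×
    (∃[ k ] (HasCard (IsSSVT-Q n la mu) k × Odd k))
corollary4p4 la mu n la-strict mu-strict _ _ (F , F-P) (G , G-Q) =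
  (_ , HasCard-cong P-valid⇔ P.valid-count , P.odd-count (Equivalence.from (P-valid⇔ F) F-P)) ,
  (_ , HasCard-cong Q-valid⇔ Q.valid-count , Q.odd-count (Equivalence.from (Q-valid⇔ G) G-Q))
  where open Fillings.SSVT {n} la mu la-strict mu-strict
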